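{- Let $(L;\wedge,\vee,^{\Delta},^{\nabla},0,1)$ be a weakly dicomplemented lattice and let $G$ be a filter of $\overline{S}(L)$. Put $F_G=\{x\in L\mid x^{\Delta\Delta}\in G\}$, for $X\subseteq L$ put $X^{\star}=\{a\in L\mid x^{\Delta}\le a\ \forall x\in X\}$, and for $X\subseteq\overline{S}(L)$ put $X^{\overline{\star}}=\{x\in\overline{S}(L)\mid a^{\Delta}\le x\ \forall a\in X\}$. Then: (1) $G^{\star}=(F_G)^{\star}=F_{G^{\overline{\star}}}$; (2) $G^{\overline{\star}\,\overline{\star}}=G$ if and only if $(F_G)^{\star\star}=F_G$.
   Context: A weakly dicomplemented lattice (WDL) is an algebra $(L;\wedge,\vee,^{\Delta},^{\nabla},0,1)$ such that $(L;\wedge,\vee,0,1)$ is a bounded lattice and, for all $x,y\in L$: $x^{\Delta\Delta}\le x$; $x\le y\Rightarrow y^{\Delta}\le x^{\Delta}$; $(x\wedge y)\vee(x\wedge y^{\Delta})=x$; $x^{\nabla\nabla}\ge x$; $x\le y\Rightarrow y^{\nabla}\le x^{\nabla}$; $(x\vee y)\wedge(x\vee y^{\nabla})=x$. $\overline{S}(L)=\{x\in L\mid x^{\Delta\Delta}=x\}$, $x\,\overline{\sqcap}\,y=(x^{\Delta}\vee y^{\Delta})^{\Delta}$; a filter of $\overline{S}(L)$ is a nonempty subset of $\overline{S}(L)$ upward closed within $\overline{S}(L)$ and closed under $\overline{\sqcap}$. -}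

module Defs where

open import Level using (Level; _⊔_; suc)
open import Data.Product using (Σ; ∃; _×_; _,_)
open import Relation.Unary using (Pred; _∈_)
open import Algebra.Lattice.Bundles using (Lattice)

record WDL (c ℓ : Level) : Set (suc (c ⊔ ℓ)) where
  field
    lattice : Lattice c ℓ
  open Lattice lattice public
  infix 4 _≤_
  _≤_ : Carrier → Carrier → Set ℓ
  x ≤ y = (x ∧ y) ≈ x
  field
    𝟘 𝟙       : Carrier
    𝟘-least   : ∀ x → 𝟘 ≤ x
    𝟙-greatest : ∀ x → x ≤ 𝟙
    _ᐞ        : Carrier → Carrier
    _ᐁ        : Carrier → Carrier
    ᐞ-cong    : ∀ {x y} → x ≈ y → (x ᐞ) ≈ (y ᐞ)
    ᐁ-cong    : ∀ {x y} → x ≈ y → (x ᐁ) ≈ (y ᐁ)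
    ᐞᐞ-≤      : ∀ x → ((x ᐞ) ᐞ) ≤ x
    ᐞ-anti    : ∀ {x y} → x ≤ y → (y ᐞ) ≤ (x ᐞ)
    ᐞ-split   : ∀ x y → ((x ∧ y) ∨ (x ∧ (y ᐞ))) ≈ x
    ᐁᐁ-≥      : ∀ x → x ≤ ((x ᐁ) ᐁ)
    ᐁ-anti    : ∀ {x y} → x ≤ y → (y ᐁ) ≤ (x ᐁ)
    ᐁ-split   : ∀ x y → ((x ∨ y) ∧ (x ∨ (y ᐁ))) ≈ x

module _ {c ℓ : Level} (L : WDL c ℓ) where
  open WDL L

  S̄ : Pred Carrier ℓ
  S̄ x = ((x ᐞ) ᐞ) ≈ x

  _⊓̄_ : Carrier → Carrier → Carrier
  x ⊓̄ y = ((x ᐞ) ∨ (y ᐞ)) ᐞ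

  record IsFilterS̄ {p : Level} (G : Pred Carrier p) : Set (c ⊔ ℓ ⊔ p) where
    field
      nonempty : ∃ λ x → x ∈ G
      ⊆S̄      : ∀ x → x ∈ G → x ∈ S̄
      up-closed : ∀ x y → x ∈ G → y ∈ S̄ → x ≤ y → y ∈ G
      ⊓̄-closed : ∀ x y → x ∈ G → y ∈ G → (x ⊓̄ y) ∈ G

  F : {p : Level} → Pred Carrier p → Pred Carrier p
  F G x = ((x ᐞ) ᐞ) ∈ G

  _⋆ : {p : Level} → Pred Carrier p → Pred Carrier (c ⊔ ℓ ⊔ p)
  (X ⋆) a = ∀ x → x ∈ X → (x ᐞ) ≤ a

  _⋆̄ : {p : Level} → Pred Carrier p → Pred Carrier (c ⊔ ℓ ⊔ p)
  (X ⋆̄) x = (x ∈ S̄) × (∀ a → a ∈ X → (a ᐞ) ≤ x)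

{-# OPTIONS --safe #-}
module Submission where

open import Defs
open import Level using (Level)
open import Data.Product using (_×_; _,_; proj₁)
open import Relation.Unary using (Pred; _∈_; _⊆_; _≐_)
open import Relation.Unary.Properties using (≐-sym; ≐-trans)
open import Relation.Binary.Definitions using (_Respects_)
open import Function.Bundles using (_⇔_; mk⇔)
open import Function.Construct.Composition using (_⇔-∘_)
import Algebra.Lattice.Properties.Lattice as LatticeProperties

-- Everything rests on x^ΔΔΔ = x^Δ.  It gives x^Δ ≤ a iff x^Δ ≤ a^ΔΔ, hence
-- X^⋆ = F_(X^⋆̄) for every X; and F_X has the same Δ-images as X, hence
-- X^⋆ = (F_X)^⋆, as soon as X ⊆ F_X, i.e. for X ⊆ S̄(L) closed under ≈ (such
-- as G and X^⋆̄).  On such sets X ↦ F_X is injective, and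
-- (F_G)^⋆⋆ = G^⋆⋆ = F_(G^⋆̄⋆̄), so (2) follows.

module _ {c ℓ : Level} (L : WDL c ℓ) where
  open WDL L
  open LatticeProperties lattice using (∧-idem)

  private variable
    p : Level
    X Y : Pred Carrier p

  ≤-reflexive : ∀ {x y} → x ≈ y → x ≤ y
  ≤-reflexive {x} x≈y = trans (∧-cong refl (sym x≈y)) (∧-idem x)

  ≤-trans : ∀ {x y z} → x ≤ y → y ≤ z → x ≤ z
  ≤-trans {x} {y} {z} x≤y y≤z =
    trans (∧-cong (sym x≤y) refl) (trans (∧-assoc x y z) (trans (∧-cong refl y≤z) x≤y))

  ≤-antisym : ∀ {x y} → x ≤ y → y ≤ x → x ≈ y
  ≤-antisym {x} {y} x≤y y≤x = trans (sym x≤y) (trans (∧-comm x y) y≤x)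

  ᐞᐞᐞ≈ᐞ : ∀ x → ((x ᐞ) ᐞ) ᐞ ≈ x ᐞ
  ᐞᐞᐞ≈ᐞ x = ≤-antisym (ᐞᐞ-≤ (x ᐞ)) (ᐞ-anti (ᐞᐞ-≤ x))

  ᐞᐞ∈S̄ : ∀ x → (x ᐞ) ᐞ ∈ S̄ L
  ᐞᐞ∈S̄ x = ᐞ-cong (ᐞᐞᐞ≈ᐞ x)

  ᐞ≤⇒ᐞ≤ᐞᐞ : ∀ {x a} → x ᐞ ≤ a → x ᐞ ≤ (a ᐞ) ᐞ
  ᐞ≤⇒ᐞ≤ᐞᐞ {x} xᐞ≤a = ≤-trans (≤-reflexive (sym (ᐞᐞᐞ≈ᐞ x))) (ᐞ-anti (ᐞ-anti xᐞ≤a))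

  S̄-resp-≈ : S̄ L Respects _≈_
  S̄-resp-≈ x≈y x∈S̄ = trans (ᐞ-cong (ᐞ-cong (sym x≈y))) (trans x∈S̄ x≈y)

  ⋆-antitone : X ⊆ Y → _⋆ L Y ⊆ _⋆ L X
  ⋆-antitone X⊆Y a∈Y⋆ x x∈X = a∈Y⋆ x (X⊆Y x∈X)

  ⋆-cong : X ≐ Y → _⋆ L X ≐ _⋆ L Y
  ⋆-cong (X⊆Y , Y⊆X) = ⋆-antitone Y⊆X , ⋆-antitone X⊆Y

  ⋆⊆F⋆ : _⋆ L X ⊆ _⋆ L (F L X)
  ⋆⊆F⋆ a∈X⋆ x xᐞᐞ∈X = ≤-trans (≤-reflexive (sym (ᐞᐞᐞ≈ᐞ x))) (a∈X⋆ _ xᐞᐞ∈X)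

  ⊆F : X ⊆ S̄ L → X Respects _≈_ → X ⊆ F L X
  ⊆F X⊆S̄ X-resp x∈X = X-resp (sym (X⊆S̄ x∈X)) x∈X

  F-reflects-⊆ : X ⊆ S̄ L → X Respects _≈_ → Y Respects _≈_ → F L X ⊆ F L Y → X ⊆ Y
  F-reflects-⊆ X⊆S̄ X-resp Y-resp FX⊆FY x∈X =
    Y-resp (X⊆S̄ x∈X) (FX⊆FY (⊆F X⊆S̄ X-resp x∈X))

  ⋆≐F⋆ : X ⊆ S̄ L → X Respects _≈_ → _⋆ L X ≐ _⋆ L (F L X)
  ⋆≐F⋆ X⊆S̄ X-resp = ⋆⊆F⋆ , ⋆-antitone (⊆F X⊆S̄ X-resp)

  ⋆≐F⋆̄ : _⋆ L X ≐ F L (_⋆̄ L X)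
  ⋆≐F⋆̄ {X = X} = to , from
    where
    to : _⋆ L X ⊆ F L (_⋆̄ L X)
    to {a} a∈X⋆ = ᐞᐞ∈S̄ a , λ x x∈X → ᐞ≤⇒ᐞ≤ᐞᐞ (a∈X⋆ x x∈X)

    from : F L (_⋆̄ L X) ⊆ _⋆ L X
    from {a} (_ , ᐞ≤aᐞᐞ) x x∈X = ≤-trans (ᐞ≤aᐞᐞ x x∈X) (ᐞᐞ-≤ a)

  ⋆̄-resp-≈ : _⋆̄ L X Respects _≈_
  ⋆̄-resp-≈ x≈y (x∈S̄ , ᐞ≤x) = S̄-resp-≈ x≈y x∈S̄ , λ a a∈X → ≤-trans (ᐞ≤x a a∈X) (≤-reflexive x≈y)

  ⋆⋆≐F⋆̄⋆̄ : _⋆ L (_⋆ L X) ≐ F L (_⋆̄ L (_⋆̄ L X))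
  ⋆⋆≐F⋆̄⋆̄ = ≐-trans (⋆-cong ⋆≐F⋆̄) (≐-trans (≐-sym (⋆≐F⋆ proj₁ ⋆̄-resp-≈)) ⋆≐F⋆̄)

  filter-resp-≈ : IsFilterS̄ L X → X Respects _≈_
  filter-resp-≈ filter x≈y x∈X =
    up-closed _ _ x∈X (S̄-resp-≈ x≈y (⊆S̄ _ x∈X)) (≤-reflexive x≈y)
    where open IsFilterS̄ filter

  ≐⇔F≐ : X ⊆ S̄ L → X Respects _≈_ → Y ⊆ S̄ L → Y Respects _≈_ →
         (X ≐ Y) ⇔ (F L X ≐ F L Y)
  ≐⇔F≐ X⊆S̄ X-resp Y⊆S̄ Y-resp = mk⇔
    (λ (X⊆Y , Y⊆X) → X⊆Y , Y⊆X)
    (λ (FX⊆FY , FY⊆FX) → F-reflects-⊆ X⊆S̄ X-resp Y-resp FX⊆FY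
                        , F-reflects-⊆ Y⊆S̄ Y-resp X-resp FY⊆FX)

proposition4p10 : ∀ {c ℓ p : Level} (L : WDL c ℓ) (G : Pred (WDL.Carrier L) p) →
    IsFilterS̄ L G →
    ((_⋆ L G ≐ _⋆ L (F L G)) × (_⋆ L (F L G) ≐ F L (_⋆̄ L G)))
    × ((_⋆̄ L (_⋆̄ L G) ≐ G) ⇔ (_⋆ L (_⋆ L (F L G)) ≐ F L G))
proposition4p10 L G filter =
  (G⋆≐FG⋆ , ≐-trans (≐-sym G⋆≐FG⋆) (⋆≐F⋆̄ L)) ,
  (mk⇔ (≐-trans FG⋆⋆≐FG⋆̄⋆̄) (≐-trans (≐-sym FG⋆⋆≐FG⋆̄⋆̄))
    ⇔-∘ ≐⇔F≐ L proj₁ (⋆̄-resp-≈ L) G⊆S̄ (filter-resp-≈ L filter))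
  where
  G⊆S̄ : G ⊆ S̄ L
  G⊆S̄ = IsFilterS̄.⊆S̄ filter _

  G⋆≐FG⋆ : _⋆ L G ≐ _⋆ L (F L G)
  G⋆≐FG⋆ = ⋆≐F⋆ L G⊆S̄ (filter-resp-≈ L filter)

  FG⋆⋆≐FG⋆̄⋆̄ : _⋆ L (_⋆ L (F L G)) ≐ F L (_⋆̄ L (_⋆̄ L G))
  FG⋆⋆≐FG⋆̄⋆̄ = ≐-trans (⋆-cong L (≐-sym G⋆≐FG⋆)) (⋆⋆≐F⋆̄⋆̄ L)
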